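{- Let $n>2$ and let $G=\{0,1,\dots,n-2\}$ be the cyclic group of order $n-1$ under addition modulo $n-1$. Let $M=G\cup\{\infty\}$ with the operation extending that of $G$ by $\infty+\infty=\infty$ and $g+\infty=\infty+g=\infty$ for all $g\in G$. Then $M$ is a commutative monoid of order $n$ with exactly two idempotents, and $M$ is not isomorphic to the sandpile monoid $\mathcal{M}(\widehat{X})$ of any sandpile graph $\widehat{X}$.
   Context: A sandpile graph $\widehat{X}$ is a finite weakly connected directed multigraph (loops and multiple edges allowed) with a distinguished vertex, the sink, reachable by a directed path from every vertex; the set of non-sink vertices is nonempty. A configuration assigns a nonnegative integer number of grains to each non-sink vertex; it is stable if every $v$ holds fewer than $\deg^{+}(v)$ (out-degree) grains. Toppling an unstable vertex sends one grain along each of its out-edges (grains at the sink vanish; the sink never topples); every configuration has a unique stabilization. The sandpile monoid $\mathcal{M}(\widehat X)$ is the set of stable configurations with $a\oplus b$ = stabilization of $a+b$. -}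

module Defs where

open import Data.Nat using (ℕ; zero; suc; _+_; _∸_; _≤_; _<_)
open import Data.Nat.DivMod using (_mod_)
open import Data.Fin using (Fin; toℕ; _≟_)
open import Data.Fin.Patterns using (0F)
open import Data.Maybe using (Maybe; just; nothing)
open import Data.List using (map; allFin)
open import Data.Nat.ListAction using (sum)
open import Data.Product using (Σ; ∃; _×_)
open import Relation.Nullary using (¬_; yes; no)
open import Relation.Binary.PropositionalEquality using (_≡_; _≗_)

-- The monoid M = G ∪ {∞}, G = Z/(n-1).  Carrier: Maybe (Fin (n ∸ 1)),
-- with  just g ↦ g ∈ G  and  nothing ↦ ∞.

addMod : ∀ {d} → Fin d → Fin d → Fin d
addMod {zero}  ()
addMod {suc d} a b = (toℕ a + toℕ b) mod (suc d)

MCarrier : ℕ → Set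
MCarrier n = Maybe (Fin (n ∸ 1))

opM : ∀ n → MCarrier n → MCarrier n → MCarrier n
opM n (just a) (just b) = just (addMod a b)
opM n (just _) nothing  = nothing
opM n nothing  _        = nothing

-- the identity 0 ∈ G (only meaningful when n ∸ 1 ≥ 1, which holds for n > 2)
zeroFin? : ∀ d → Maybe (Fin d)
zeroFin? zero    = nothing
zeroFin? (suc d) = just 0F

εM : ∀ n → MCarrier n
εM n = zeroFin? (n ∸ 1)

IsIdempotent : ∀ n → MCarrier n → Set
IsIdempotent n x = opM n x x ≡ x

-- Non-sink vertices: Fin k (k ≥ 1); vertices of the
-- whole graph: Maybe (Fin k), with  nothing = the sink.
-- edge v w = number of directed edges from non-sink v to w (loops and
-- multiple edges allowed).  Out-edges of the sink play no role.

Vertex : ℕ → Set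
Vertex k = Maybe (Fin k)

data ReachesSink {k : ℕ} (edge : Fin k → Vertex k → ℕ) : Vertex k → Set where
  at-sink : ReachesSink edge nothing
  step    : ∀ {v w} → 0 < edge v w → ReachesSink edge w → ReachesSink edge (just v)

record SandpileGraph : Set where
  field
    k        : ℕ
    nonempty : 0 < k
    edge     : Fin k → Vertex k → ℕ
    reach    : ∀ v → ReachesSink edge (just v)

module _ (X : SandpileGraph) where
  open SandpileGraph X

  Config : Set
  Config = Fin k → ℕ

  outdeg : Fin k → ℕ
  outdeg v = edge v nothing + sum (map (λ u → edge v (just u)) (allFin k))

  Stable : Config → Set
  Stable c = ∀ v → c v < outdeg v

  _+c_ : Config → Config → Config
  (a +c b) v = a v + b v

  topple : Fin k → Config → Config
  topple v c w with v ≟ w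
  ... | yes _ = (c w ∸ outdeg v) + edge v (just w)
  ... | no  _ = c w + edge v (just w)

  data _⇝_ : Config → Config → Set where
    done : ∀ {c d} → c ≗ d → c ⇝ d
    step : ∀ {c d} v → outdeg v ≤ c v → topple v c ⇝ d → c ⇝ d

  StabilizesTo : Config → Config → Set
  StabilizesTo c s = (c ⇝ s) × Stable s

  -- M(X) = stable configurations, a ⊕ b = stabilization of a + b.
  -- An isomorphism from the monoid (MCarrier n, ⊕M) onto M(X):
  record IsoToSandpileMonoid (n : ℕ) : Set where
    field
      φ        : MCarrier n → Config
      φ-stable : ∀ x → Stable (φ x)
      φ-inj    : ∀ x y → φ x ≗ φ y → x ≡ y
      φ-surj   : ∀ s → Stable s → ∃ λ x → φ x ≗ s
      φ-hom    : ∀ x y → StabilizesTo (φ x +c φ y) (φ (opM n x y))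

module Submission where

open import Defs
open import Data.Nat
  using (ℕ; suc; _+_; _*_; _∸_; _≤_; _<_; _%_; NonZero; _≤?_; s≤s; s≤s⁻¹)
open import Data.Nat.Properties
  using (+-comm; +-assoc; +-cancelˡ-≡; +-cancelʳ-≡; +-identityʳ;
         m≤m+n; m≤n+m; m+[n∸m]≡n; m∸n≡0⇒m≤n;
         ≤-trans; ≤-<-trans; <⇒≱; ≤-reflexive; ≤-antisym; ≰⇒>)
open import Data.Nat.DivMod
  using (_mod_; %-distribˡ-+; m%n%n≡m%n; m<n⇒m%n≡m; m*n%n≡0; m≡m%n+[m/n]*n; _/_)
open import Data.Fin using (Fin; toℕ; _≟_)
open import Data.Fin.Patterns using (0F; 1F)
open import Data.Fin.Properties using (toℕ-injective; toℕ-fromℕ<; toℕ<n)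
open import Data.Maybe using (Maybe; just; nothing)
open import Data.Maybe.Properties using (just-injective)
open import Data.Product using (_×_; ∃₂; _,_; proj₁)
open import Data.Sum using (_⊎_; inj₁; inj₂)
open import Relation.Nullary using (¬_; yes; no; contradiction)
open import Relation.Binary.PropositionalEquality
  using (_≡_; _≢_; _≗_; refl; sym; trans; cong; cong₂; subst; module ≡-Reasoning)
open import Relation.Binary.PropositionalEquality.Algebra using (isMagma)
open import Algebra.Definitions using (Associative; Commutative; LeftIdentity)
open import Algebra.Structures using (IsCommutativeMonoid)
open import Algebra.Structures.Biased using (isCommutativeMonoidˡ)
open import Function.Bundles using (_↔_; mk↔ₛ′)

-- The element ∞ of M is absorbing, and it is prime: x + y = ∞ only if x = ∞ or y = ∞.
-- Let z be the configuration representing ∞.  Absorption says that c + z stable forces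
-- c = 0; applied to a single grain at v it gives outdeg v ≤ z v + 1, so every stable
-- configuration lies below z.  Primality says z is not a sum of two nonzero
-- configurations, so z − c = 0 or c = 0 for every stable c.  Hence the sandpile monoid
-- has at most the two elements 0 and z, while M has n ≥ 3 elements.

[m%d+n]%d≡[m+n]%d : ∀ m n d .{{_ : NonZero d}} → (m % d + n) % d ≡ (m + n) % d
[m%d+n]%d≡[m+n]%d m n d = begin
  (m % d + n) % d          ≡⟨ %-distribˡ-+ (m % d) n d ⟩
  (m % d % d + n % d) % d  ≡⟨ cong (λ t → (t + n % d) % d) (m%n%n≡m%n m d) ⟩
  (m % d + n % d) % d      ≡⟨ %-distribˡ-+ m n d ⟨
  (m + n) % d              ∎
  where open ≡-Reasoning

module _ {d : ℕ} where

  toℕ-addMod : ∀ (a b : Fin (suc d)) → toℕ (addMod a b) ≡ (toℕ a + toℕ b) % suc d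
  toℕ-addMod a b = toℕ-fromℕ< _

  addMod-comm : Commutative _≡_ (addMod {suc d})
  addMod-comm a b = cong (_mod suc d) (+-comm (toℕ a) (toℕ b))

  addMod-assoc : Associative _≡_ (addMod {suc d})
  addMod-assoc a b c = toℕ-injective (begin
    toℕ (addMod (addMod a b) c)      ≡⟨ toℕ-addMod (addMod a b) c ⟩
    (toℕ (addMod a b) + z) % m       ≡⟨ cong (λ t → (t + z) % m) (toℕ-addMod a b) ⟩
    ((x + y) % m + z) % m            ≡⟨ [m%d+n]%d≡[m+n]%d (x + y) z m ⟩
    (x + y + z) % m                  ≡⟨ cong (_% m) (trans (+-assoc x y z) (+-comm x (y + z))) ⟩
    (y + z + x) % m                  ≡⟨ [m%d+n]%d≡[m+n]%d (y + z) x m ⟨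
    ((y + z) % m + x) % m            ≡⟨ cong (λ t → (t + x) % m) (toℕ-addMod b c) ⟨
    (toℕ (addMod b c) + x) % m       ≡⟨ toℕ-addMod (addMod b c) a ⟨
    toℕ (addMod (addMod b c) a)      ≡⟨ cong toℕ (addMod-comm (addMod b c) a) ⟩
    toℕ (addMod a (addMod b c))      ∎)
    where
      open ≡-Reasoning
      m = suc d
      x = toℕ a
      y = toℕ b
      z = toℕ c

  addMod-identityˡ : LeftIdentity _≡_ 0F (addMod {suc d})
  addMod-identityˡ a = toℕ-injective (trans (toℕ-addMod 0F a) (m<n⇒m%n≡m (toℕ<n a)))

  addMod-idem⇒≡0 : ∀ (a : Fin (suc d)) → addMod a a ≡ a → a ≡ 0F
  addMod-idem⇒≡0 a a+a≡a = toℕ-injective (begin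
    x              ≡⟨ m<n⇒m%n≡m (toℕ<n a) ⟨
    x % m          ≡⟨ cong (_% m) x≡q*m ⟩
    q * m % m      ≡⟨ m*n%n≡0 q m ⟩
    0              ∎)
    where
      open ≡-Reasoning
      m = suc d
      x = toℕ a
      q = (x + x) / m
      x≡q*m : x ≡ q * m
      x≡q*m = +-cancelˡ-≡ x x (q * m) (begin
        x + x                ≡⟨ m≡m%n+[m/n]*n (x + x) m ⟩
        (x + x) % m + q * m  ≡⟨ cong (_+ q * m) (trans (sym (toℕ-addMod a a)) (cong toℕ a+a≡a)) ⟩
        x + q * m            ∎)

Maybe-Fin↔Fin-suc : ∀ {d} → Maybe (Fin d) ↔ Fin (suc d)
Maybe-Fin↔Fin-suc = mk↔ₛ′ to from (λ { 0F → refl ; (Fin.suc i) → refl })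
                               (λ { nothing → refl ; (just i) → refl })
  where
    to : ∀ {d} → Maybe (Fin d) → Fin (suc d)
    to nothing  = 0F
    to (just i) = Fin.suc i
    from : ∀ {d} → Fin (suc d) → Maybe (Fin d)
    from 0F          = nothing
    from (Fin.suc i) = just i

module _ {d : ℕ} where

  private
    n = 2 + d

  opM-assoc : Associative _≡_ (opM n)
  opM-assoc (just a) (just b) (just c) = cong just (addMod-assoc a b c)
  opM-assoc (just a) (just b) nothing  = refl
  opM-assoc (just a) nothing  c        = refl
  opM-assoc nothing  b        c        = refl

  opM-comm : Commutative _≡_ (opM n)
  opM-comm (just a) (just b) = cong just (addMod-comm a b)
  opM-comm (just a) nothing  = refl
  opM-comm nothing  (just b) = refl
  opM-comm nothing  nothing  = refl

  opM-identityˡ : LeftIdentity _≡_ (εM n) (opM n)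
  opM-identityˡ (just a) = cong just (addMod-identityˡ a)
  opM-identityˡ nothing  = refl

  opM-isCommutativeMonoid : IsCommutativeMonoid _≡_ (opM n) (εM n)
  opM-isCommutativeMonoid = isCommutativeMonoidˡ record
    { isSemigroup = record { isMagma = isMagma (opM n) ; assoc = opM-assoc }
    ; identityˡ   = opM-identityˡ
    ; comm        = opM-comm
    }

  opM-idempotent : ∀ x → IsIdempotent n x → x ≡ nothing ⊎ x ≡ εM n
  opM-idempotent nothing  _      = inj₁ refl
  opM-idempotent (just a) a+a≡a = inj₂ (cong just (addMod-idem⇒≡0 a (just-injective a+a≡a)))

opM-zeroʳ : ∀ n x → opM n x nothing ≡ nothing
opM-zeroʳ n (just a) = refl
opM-zeroʳ n nothing  = refl

opM≡nothing : ∀ n x y → opM n x y ≡ nothing → x ≡ nothing ⊎ y ≡ nothing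
opM≡nothing n (just a) (just b) ()
opM≡nothing n (just a) nothing  _ = inj₂ refl
opM≡nothing n nothing  y        _ = inj₁ refl

module _ (X : SandpileGraph) where

  open SandpileGraph X

  private
    infixl 6 _+ᶜ_
    _+ᶜ_ : Config X → Config X → Config X
    _+ᶜ_ = _+c_ X

  𝟘 : Config X
  𝟘 _ = 0

  δ : Fin k → Config X
  δ u v with u ≟ v
  ... | yes _ = 1
  ... | no  _ = 0

  δ-diag : ∀ u → δ u u ≡ 1
  δ-diag u with u ≟ u
  ... | yes _   = refl
  ... | no  u≢u = contradiction refl u≢u

  stable-downward : ∀ {c s} → Stable X s → (∀ v → c v ≤ s v) → Stable X c
  stable-downward s-stable c≤s v = ≤-<-trans (c≤s v) (s-stable v)

  stable⇒⇝⇒≗ : ∀ {s t} → Stable X s → _⇝_ X s t → s ≗ t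
  stable⇒⇝⇒≗ _        (done s≗t)      = s≗t
  stable⇒⇝⇒≗ s-stable (step v unst _) = contradiction unst (<⇒≱ (s-stable v))

  module _ {n : ℕ} (I : IsoToSandpileMonoid X n) where

    open IsoToSandpileMonoid I

    private
      z : Config X
      z = φ nothing

      z-stable : Stable X z
      z-stable = φ-stable nothing

    φ-+ : ∀ {x y c d} → φ x ≗ c → φ y ≗ d → Stable X (c +ᶜ d) → c +ᶜ d ≗ φ (opM n x y)
    φ-+ {x} {y} {c} {d} φx≗c φy≗d c+d-stable v =
      trans (sym (φx+φy≗c+d v)) (stable⇒⇝⇒≗ φx+φy-stable (proj₁ (φ-hom x y)) v)
      where
        φx+φy≗c+d : φ x +ᶜ φ y ≗ c +ᶜ d
        φx+φy≗c+d v = cong₂ _+_ (φx≗c v) (φy≗d v)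
        φx+φy-stable : Stable X (φ x +ᶜ φ y)
        φx+φy-stable = stable-downward c+d-stable (λ v → ≤-reflexive (φx+φy≗c+d v))

    +z-stable⇒≗𝟘 : ∀ {c} → Stable X (c +ᶜ z) → c ≗ 𝟘
    +z-stable⇒≗𝟘 {c} c+z-stable v
      with φ-surj c (stable-downward c+z-stable (λ v → m≤m+n (c v) (z v)))
    ... | x , φx≗c = +-cancelʳ-≡ (z v) (c v) 0 (begin
      c v + z v              ≡⟨ φ-+ φx≗c (λ _ → refl) c+z-stable v ⟩
      φ (opM n x nothing) v  ≡⟨ cong (λ y → φ y v) (opM-zeroʳ n x) ⟩
      z v                    ∎)
      where open ≡-Reasoning

    outdeg≤1+z : ∀ w → outdeg X w ≤ suc (z w)
    outdeg≤1+z w with outdeg X w ≤? suc (z w)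
    ... | yes le = le
    ... | no  gt = contradiction (trans (sym (δ-diag w)) (+z-stable⇒≗𝟘 δw+z-stable w)) λ ()
      where
        δw+z-stable : Stable X (δ w +ᶜ z)
        δw+z-stable v with w ≟ v
        ... | yes refl = ≰⇒> gt
        ... | no  _    = z-stable v

    stable⇒≤z : ∀ {c} → Stable X c → ∀ v → c v ≤ z v
    stable⇒≤z c-stable v = s≤s⁻¹ (≤-trans (c-stable v) (outdeg≤1+z v))

    +≗z⇒≗𝟘 : ∀ {c d} → c +ᶜ d ≗ z → c ≗ 𝟘 ⊎ d ≗ 𝟘
    +≗z⇒≗𝟘 {c} {d} c+d≗z
      with φ-surj c (stable-downward z-stable λ v → ≤-trans (m≤m+n (c v) (d v)) (c+d≤z v))
         | φ-surj d (stable-downward z-stable λ v → ≤-trans (m≤n+m (d v) (c v)) (c+d≤z v))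
      where
        c+d≤z : ∀ v → c v + d v ≤ z v
        c+d≤z v = ≤-reflexive (c+d≗z v)
    ... | x , φx≗c | y , φy≗d with opM≡nothing n x y (φ-inj (opM n x y) nothing φxy≗z)
      where
        c+d-stable : Stable X (c +ᶜ d)
        c+d-stable v = subst (_< outdeg X v) (sym (c+d≗z v)) (z-stable v)
        φxy≗z : φ (opM n x y) ≗ z
        φxy≗z v = trans (sym (φ-+ φx≗c φy≗d c+d-stable v)) (c+d≗z v)
    ... | inj₁ refl = inj₂ λ v →
      +-cancelˡ-≡ (c v) (d v) 0 (trans (c+d≗z v) (trans (φx≗c v) (sym (+-identityʳ (c v)))))
    ... | inj₂ refl = inj₁ λ v →
      +-cancelʳ-≡ (d v) (c v) 0 (trans (c+d≗z v) (φy≗d v))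

    stable⇒≗𝟘⊎≗z : ∀ {c} → Stable X c → c ≗ 𝟘 ⊎ c ≗ z
    stable⇒≗𝟘⊎≗z {c} c-stable with +≗z⇒≗𝟘 {c} {λ v → z v ∸ c v} c+[z∸c]≗z
      where
        c+[z∸c]≗z : ∀ v → c v + (z v ∸ c v) ≡ z v
        c+[z∸c]≗z v = m+[n∸m]≡n (stable⇒≤z c-stable v)
    ... | inj₁ c≗𝟘   = inj₁ c≗𝟘
    ... | inj₂ z∸c≗𝟘 = inj₂ λ v → ≤-antisym (stable⇒≤z c-stable v) (m∸n≡0⇒m≤n (z∸c≗𝟘 v))

    φ-just≗𝟘 : ∀ a → φ (just a) ≗ 𝟘
    φ-just≗𝟘 a with stable⇒≗𝟘⊎≗z (φ-stable (just a))
    ... | inj₁ φa≗𝟘 = φa≗𝟘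
    ... | inj₂ φa≗z with φ-inj (just a) nothing φa≗z
    ...   | ()

¬IsoToSandpileMonoid : ∀ X k → ¬ IsoToSandpileMonoid X (3 + k)
¬IsoToSandpileMonoid X k I with φ-inj (just 0F) (just 1F) φ0≗φ1
  where
    open IsoToSandpileMonoid I
    φ0≗φ1 : φ (just 0F) ≗ φ (just 1F)
    φ0≗φ1 v = trans (φ-just≗𝟘 X I 0F v) (sym (φ-just≗𝟘 X I 1F v))
... | ()

theorem5p4 : ∀ (n : ℕ) → 2 < n →
    IsCommutativeMonoid (_≡_ {A = MCarrier n}) (opM n) (εM n)
    × (MCarrier n ↔ Fin n)
    × (∃₂ λ (e₁ e₂ : MCarrier n) → e₁ ≢ e₂ × IsIdempotent n e₁ × IsIdempotent n e₂
         × (∀ x → IsIdempotent n x → x ≡ e₁ ⊎ x ≡ e₂))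
    × (∀ (X : SandpileGraph) → ¬ IsoToSandpileMonoid X n)
theorem5p4 (suc (suc (suc k))) (s≤s (s≤s (s≤s _))) =
    opM-isCommutativeMonoid
  , Maybe-Fin↔Fin-suc
  , (nothing , εM n , (λ ()) , refl , opM-identityˡ (εM n) , opM-idempotent)
  , (λ X → ¬IsoToSandpileMonoid X k)
  where n = 3 + k
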